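{- Let $h=(v_1,\dots,v_m)$ be a sequence of nodes, let $t_R$ and $t_D$ be time functions on pairs of nodes, and let $1\le i<j<k\le m$. If the drone is fast in operation $o_{i,j,k}$, then for every pair of indices $i',k'$ with $1\le i'\le i$ and $k\le k'\le m$, the operation $o_{i,j,k}$ dominates $o_{i',j,k'}$ with respect to $h$; that is, \[ t(o_{i',j,k'}) \ge \sum_{\ell=i'}^{i-1} t_R(v_\ell,v_{\ell+1}) + t(o_{i,j,k}) + \sum_{\ell=k}^{k'-1} t_R(v_\ell,v_{\ell+1}). \]
   Context: For indices $1\le a<b<c\le m$, the operation $o_{a,b,c}=(r,d)$ has truck path $r=(v_a,\dots,v_{b-1},v_{b+1},\dots,v_c)$ and drone path $d=(v_a,v_b,v_c)$, with $t(r)=\sum_{\ell=a}^{b-2}t_R(v_\ell,v_{\ell+1})+t_R(v_{b-1},v_{b+1})+\sum_{\ell=b+1}^{c-1}t_R(v_\ell,v_{\ell+1})$, $t(d)=t_D(v_a,v_b)+t_D(v_b,v_c)$, and $t(o_{a,b,c})=\max\{t(r),t(d)\}$. The drone is fast in $o_{a,b,c}$ if $t(d)\le t(r)$. Operation $o_{a,b,c}$ dominates $o_{a',b',c'}$ with respect to $h$ if $a'\le a$, $c'\ge c$, and $t(o_{a',b',c'})\ge \sum_{\ell=a'}^{a-1}t_R(v_\ell,v_{\ell+1})+t(o_{a,b,c})+\sum_{\ell=c}^{c'-1}t_R(v_\ell,v_{\ell+1})$.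
   Formalization: The time functions $t_R$ and $t_D$ on pairs of nodes take rational values. -}

module Defs where

open import Data.Nat using (ℕ; zero; suc; _∸_)
open import Data.Rational using (ℚ; 0ℚ; _+_; _⊔_; _≤_)
open import Data.Product using (_×_)

-- Times are rationals (no reals in the stdlib).  A sequence h = (v_1,...,v_m)
-- is a function v : ℕ → V of which only indices 1..m are used.

legs : {V : Set} → (ℕ → V) → (V → V → ℚ) → ℕ → ℕ → ℚ
legs v tR a zero    = 0ℚ
legs v tR a (suc n) = tR (v a) (v (suc a)) + legs v tR (suc a) n

-- sumR v tR a b = Σ_{ℓ=a}^{b-1} tR (v ℓ) (v (ℓ+1))   (empty if b ≤ a)
sumR : {V : Set} → (ℕ → V) → (V → V → ℚ) → ℕ → ℕ → ℚ
sumR v tR a b = legs v tR a (b ∸ a)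

truckTime : {V : Set} → (ℕ → V) → (V → V → ℚ) → ℕ → ℕ → ℕ → ℚ
truckTime v tR a b c =
  sumR v tR a (b ∸ 1) + tR (v (b ∸ 1)) (v (suc b)) + sumR v tR (suc b) c

droneTime : {V : Set} → (ℕ → V) → (V → V → ℚ) → ℕ → ℕ → ℕ → ℚ
droneTime v tD a b c = tD (v a) (v b) + tD (v b) (v c)

opTime : {V : Set} → (ℕ → V) → (V → V → ℚ) → (V → V → ℚ) → ℕ → ℕ → ℕ → ℚ
opTime v tR tD a b c = truckTime v tR a b c ⊔ droneTime v tD a b c

DroneFast : {V : Set} → (ℕ → V) → (V → V → ℚ) → (V → V → ℚ) → ℕ → ℕ → ℕ → Set
DroneFast v tR tD a b c = droneTime v tD a b c ≤ truckTime v tR a b c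

Dominates : {V : Set} → (ℕ → V) → (V → V → ℚ) → (V → V → ℚ) →
            ℕ → ℕ → ℕ → ℕ → ℕ → ℕ → Set
Dominates v tR tD a b c a' b' c' =
  (a' Data.Nat.≤ a) × (c Data.Nat.≤ c') ×
  (sumR v tR a' a + opTime v tR tD a b c + sumR v tR c c'
     ≤ opTime v tR tD a' b' c')

module Submission where

open import Defs
open import Data.Nat using (ℕ; _≤_; _<_; suc; zero; _∸_; s≤s)
open import Data.Rational using (ℚ)
import Data.Nat as ℕ
import Data.Nat.Properties as ℕₚ
import Data.Rational as ℚ
import Data.Rational.Properties as ℚₚ
open import Data.Product using (_,_)
open import Relation.Binary.PropositionalEquality

-- When the drone is fast, o_{i,j,k} takes exactly its truck time, and the truck
-- path of o_{i',j,k'} is that of o_{i,j,k} extended by the legs i'..i and k..k';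
-- its truck time alone therefore already bounds the dominance sum.

module _ {V : Set} (v : ℕ → V) (tR : V → V → ℚ) where

  legs-+ : ∀ a n p → legs v tR a (n ℕ.+ p) ≡ legs v tR a n ℚ.+ legs v tR (a ℕ.+ n) p
  legs-+ a zero p rewrite ℕₚ.+-identityʳ a = sym (ℚₚ.+-identityˡ _)
  legs-+ a (suc n) p rewrite legs-+ (suc a) n p | ℕₚ.+-suc a n =
    sym (ℚₚ.+-assoc (tR (v a) (v (suc a))) _ _)

  sumR-split : ∀ {a b c} → a ≤ b → b ≤ c → sumR v tR a c ≡ sumR v tR a b ℚ.+ sumR v tR b c
  sumR-split {a} {b} {c} a≤b b≤c = begin
    legs v tR a (c ∸ a)                                   ≡⟨ cong (legs v tR a) c∸a≡ ⟩
    legs v tR a ((b ∸ a) ℕ.+ (c ∸ b))                     ≡⟨ legs-+ a (b ∸ a) (c ∸ b) ⟩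
    legs v tR a (b ∸ a) ℚ.+ legs v tR (a ℕ.+ (b ∸ a)) (c ∸ b)
      ≡⟨ cong (λ x → legs v tR a (b ∸ a) ℚ.+ legs v tR x (c ∸ b)) (ℕₚ.m+[n∸m]≡n a≤b) ⟩
    legs v tR a (b ∸ a) ℚ.+ legs v tR b (c ∸ b)           ∎
    where
    open ≡-Reasoning
    c∸a≡ : c ∸ a ≡ (b ∸ a) ℕ.+ (c ∸ b)
    c∸a≡ = begin
      c ∸ a                   ≡⟨ cong (_∸ a) (ℕₚ.m∸n+n≡m b≤c) ⟨
      (c ∸ b) ℕ.+ b ∸ a       ≡⟨ ℕₚ.+-∸-assoc (c ∸ b) a≤b ⟩
      (c ∸ b) ℕ.+ (b ∸ a)     ≡⟨ ℕₚ.+-comm (c ∸ b) (b ∸ a) ⟩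
      (b ∸ a) ℕ.+ (c ∸ b)     ∎

  truckTime-extend : ∀ {a' a b c c'} → a' ≤ a → a ≤ b ∸ 1 → suc b ≤ c → c ≤ c' →
    truckTime v tR a' b c' ≡ sumR v tR a' a ℚ.+ truckTime v tR a b c ℚ.+ sumR v tR c c'
  truckTime-extend {a'} {a} {b} {c} {c'} a'≤a a≤b-1 b+1≤c c≤c' = begin
    sumR v tR a' (b ∸ 1) ℚ.+ T ℚ.+ sumR v tR (suc b) c'
      ≡⟨ cong₂ (λ x y → x ℚ.+ T ℚ.+ y) (sumR-split a'≤a a≤b-1) (sumR-split b+1≤c c≤c') ⟩
    (A ℚ.+ B) ℚ.+ T ℚ.+ (C ℚ.+ D)   ≡⟨ cong (ℚ._+ (C ℚ.+ D)) (ℚₚ.+-assoc A B T) ⟩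
    A ℚ.+ (B ℚ.+ T) ℚ.+ (C ℚ.+ D)   ≡⟨ ℚₚ.+-assoc A (B ℚ.+ T) (C ℚ.+ D) ⟩
    A ℚ.+ ((B ℚ.+ T) ℚ.+ (C ℚ.+ D)) ≡⟨ cong (A ℚ.+_) (ℚₚ.+-assoc (B ℚ.+ T) C D) ⟨
    A ℚ.+ ((B ℚ.+ T) ℚ.+ C ℚ.+ D)   ≡⟨ ℚₚ.+-assoc A ((B ℚ.+ T) ℚ.+ C) D ⟨
    A ℚ.+ (B ℚ.+ T ℚ.+ C) ℚ.+ D     ∎
    where
    open ≡-Reasoning
    A = sumR v tR a' a
    B = sumR v tR a (b ∸ 1)
    T = tR (v (b ∸ 1)) (v (suc b))
    C = sumR v tR (suc b) c
    D = sumR v tR c c'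

  module _ (tD : V → V → ℚ) where

    opTime-of-DroneFast : ∀ {a b c} → DroneFast v tR tD a b c →
      opTime v tR tD a b c ≡ truckTime v tR a b c
    opTime-of-DroneFast = ℚₚ.p≥q⇒p⊔q≡p

    truckTime≤opTime : ∀ a b c → truckTime v tR a b c ℚ.≤ opTime v tR tD a b c
    truckTime≤opTime a b c = ℚₚ.p≤p⊔q _ _

lemma3 : {V : Set} (m : ℕ) (v : ℕ → V) (tR tD : V → V → ℚ) (i j k : ℕ) →
    1 ≤ i → i < j → j < k → k ≤ m →
    DroneFast v tR tD i j k →
    (i' k' : ℕ) → 1 ≤ i' → i' ≤ i → k ≤ k' → k' ≤ m →
    Dominates v tR tD i j k i' j k'
lemma3 m v tR tD i (suc j) k _ (s≤s i≤j) j<k _ fast i' k' _ i'≤i k≤k' _ =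
  i'≤i , k≤k' , bound
  where
  bound : sumR v tR i' i ℚ.+ opTime v tR tD i (suc j) k ℚ.+ sumR v tR k k'
          ℚ.≤ opTime v tR tD i' (suc j) k'
  bound = begin
    sumR v tR i' i ℚ.+ opTime v tR tD i (suc j) k ℚ.+ sumR v tR k k'
      ≡⟨ cong (λ x → sumR v tR i' i ℚ.+ x ℚ.+ sumR v tR k k')
              (opTime-of-DroneFast v tR tD fast) ⟩
    sumR v tR i' i ℚ.+ truckTime v tR i (suc j) k ℚ.+ sumR v tR k k'
      ≡⟨ truckTime-extend v tR i'≤i i≤j j<k k≤k' ⟨
    truckTime v tR i' (suc j) k'
      ≤⟨ truckTime≤opTime v tR tD i' (suc j) k' ⟩
    opTime v tR tD i' (suc j) k' ∎
    where open ℚₚ.≤-Reasoning
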